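{- Let $\mathbf A=(A,\wedge,\vee,\neg,0,1)$ be a bounded involutive lattice. The following are equivalent: (1) $\mathbf A$ is an orthomodular lattice; (2) $\mathbf A$ satisfies the quasiequation $x\le y\implies y\cdot x\approx x$; (3) $\mathbf A$ satisfies $x\cdot(x\Rightarrow y)\le y$; (4) the Sasaki product $\cdot$ is residuated (so $\mathbf A$ is a residuated ortholattice) and $\mathbf A$ satisfies $x\cdot y\approx x\odot y$, where $\odot$ is the co-residual of $\Rightarrow$, i.e. the operation with $y\le x\Rightarrow z\iff x\odot y\le z$; (5) $\cdot$ is residuated with residual $\backslash$ and $\mathbf A$ satisfies $x\backslash y\approx x\Rightarrow y$; (6) $\cdot$ is residuated and its residual $\backslash$ is definable by a term in the language $\{\wedge,\vee,\neg,0,1\}$.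
   Context: A bounded involutive lattice is a bounded lattice with an order-reversing involution $\neg$. Sasaki product: $x\cdot y:=x\wedge(\neg x\vee y)$; Sasaki hook: $x\Rightarrow y:=\neg x\vee(x\wedge y)$. The product $\cdot$ is residuated if there is a binary operation $\backslash$ with $x\cdot y\le z\iff y\le x\backslash z$ for all $x,y,z$; a residuated ortholattice is a bounded involutive lattice expanded by such a $\backslash$. An ortholattice satisfies $x\wedge\neg x\approx0$; an orthomodular lattice is an ortholattice satisfying $x\le y\implies y\approx x\vee(y\wedge\neg x)$. -}

module Defs where

open import Level using (Level; _⊔_; suc)
open import Algebra.Core using (Op₁; Op₂)
open import Algebra.Lattice.Bundles using (Lattice)
open import Data.Product using (Σ; _×_; _,_)
open import Function.Bundles using (_⇔_)

record BoundedInvolutiveLattice (c ℓ : Level) : Set (suc (c ⊔ ℓ)) where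
  field
    lattice : Lattice c ℓ
  open Lattice lattice public
  infix 4 _≤_
  _≤_ : Carrier → Carrier → Set ℓ
  x ≤ y = (x ∧ y) ≈ x
  field
    ¬_        : Op₁ Carrier
    𝟘 𝟙       : Carrier
    ¬-cong    : ∀ {x y} → x ≈ y → (¬ x) ≈ (¬ y)
    ¬-invol   : ∀ x → (¬ (¬ x)) ≈ x
    ¬-antitone : ∀ {x y} → x ≤ y → (¬ y) ≤ (¬ x)
    𝟘-least   : ∀ x → 𝟘 ≤ x
    𝟙-greatest : ∀ x → x ≤ 𝟙

module Sasaki {c ℓ} (A : BoundedInvolutiveLattice c ℓ) where
  open BoundedInvolutiveLattice A

  _·_ : Op₂ Carrier
  x · y = x ∧ ((¬ x) ∨ y)

  _⇒_ : Op₂ Carrier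
  x ⇒ y = (¬ x) ∨ (x ∧ y)

  IsOrtholattice : Set (c ⊔ ℓ)
  IsOrtholattice = ∀ x → (x ∧ (¬ x)) ≈ 𝟘

  IsOrthomodular : Set (c ⊔ ℓ)
  IsOrthomodular = IsOrtholattice × (∀ x y → x ≤ y → y ≈ (x ∨ (y ∧ (¬ x))))

  IsResidualOf· : Op₂ Carrier → Set (c ⊔ ℓ)
  IsResidualOf· r = ∀ x y z → ((x · y) ≤ z) ⇔ (y ≤ r x z)

  Residuated : Set (c ⊔ ℓ)
  Residuated = Σ (Op₂ Carrier) IsResidualOf·

  IsCoResidualOf⇒ : Op₂ Carrier → Set (c ⊔ ℓ)
  IsCoResidualOf⇒ o = ∀ x y z → (y ≤ (x ⇒ z)) ⇔ (o x y ≤ z)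

data Term₂ : Set where
  varX varY : Term₂
  _∧ₜ_ _∨ₜ_ : Term₂ → Term₂ → Term₂
  ¬ₜ_       : Term₂ → Term₂
  0ₜ 1ₜ     : Term₂

module _ {c ℓ} (A : BoundedInvolutiveLattice c ℓ) where
  open BoundedInvolutiveLattice A

  ⟦_⟧ : Term₂ → Carrier → Carrier → Carrier
  ⟦ varX ⟧ x y = x
  ⟦ varY ⟧ x y = y
  ⟦ s ∧ₜ t ⟧ x y = ⟦ s ⟧ x y ∧ ⟦ t ⟧ x y
  ⟦ s ∨ₜ t ⟧ x y = ⟦ s ⟧ x y ∨ ⟦ t ⟧ x y
  ⟦ ¬ₜ t ⟧ x y = ¬ (⟦ t ⟧ x y)
  ⟦ 0ₜ ⟧ x y = 𝟘
  ⟦ 1ₜ ⟧ x y = 𝟙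

module Conditions {c ℓ} (A : BoundedInvolutiveLattice c ℓ) where
  open BoundedInvolutiveLattice A
  open Sasaki A public

  Cond1 Cond2 Cond3 Cond4 Cond5 Cond6 : Set (c ⊔ ℓ)
  Cond1 = IsOrthomodular
  Cond2 = ∀ x y → x ≤ y → (y · x) ≈ x
  Cond3 = ∀ x y → (x · (x ⇒ y)) ≤ y
  Cond4 = Residuated ×
          Σ (Op₂ Carrier) (λ ⊙ → IsCoResidualOf⇒ ⊙ × (∀ x y → (x · y) ≈ ⊙ x y))
  Cond5 = Σ (Op₂ Carrier) (λ \\ → IsResidualOf· \\ × (∀ x y → \\ x y ≈ (x ⇒ y)))
  Cond6 = Σ Term₂ (λ t → IsResidualOf· (⟦_⟧ A t))

{-# OPTIONS --safe #-}
-- Every condition is tied to the adjunction  x · y ≤ z ⇔ y ≤ x ⇒ z.  Orthomodularity is,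
-- up to the duality ¬, the absorption law y · x ≈ x for x ≤ y; absorption gives the counit
-- x · (x ⇒ z) ≤ z, and the orthomodular law gives the unit y ≤ ¬x ∨ y ≈ x ⇒ (x · y), so
-- ⇒ is the residual.  Conversely, any residual forces x · 𝟘 ≈ 𝟘, i.e. x ∧ ¬x ≈ 𝟘.  If the
-- residual is moreover a lattice term, then its value at (y, ¬y) lies in the subalgebra
-- {𝟘, 𝟙, y, ¬y}; going through the four cases shows that x ≤ y and y ∧ ¬x ≈ 𝟘 imply x ≈ y,
-- which in an ortholattice is equivalent to orthomodularity.
module Submission where

open import Defs
open import Level using (_⊔_)
open import Data.Product using (_×_; _,_)
open import Function.Base using (_∘_)
open import Function.Bundles using (_⇔_; mk⇔; Equivalence)
import Function.Properties.Equivalence as ⇔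
import Algebra.Lattice.Properties.Lattice as AlgebraicLatticeProperties
import Relation.Binary.Lattice as OrderTheoretic
import Relation.Binary.Lattice.Properties.JoinSemilattice as JoinSemilatticeProperties
import Relation.Binary.Lattice.Properties.MeetSemilattice as MeetSemilatticeProperties
import Relation.Binary.Lattice.Properties.BoundedJoinSemilattice as BoundedJoinSemilatticeProperties
import Relation.Binary.Reasoning.PartialOrder as ≤-Reasoning

module Properties {c ℓ} (A : BoundedInvolutiveLattice c ℓ) where
  open BoundedInvolutiveLattice A
  open Conditions A
  open Equivalence using (to; from)

  -- The library orders a lattice by  x ≈ x ∧ y,  whereas A uses  x ∧ y ≈ x.
  orderTheoreticLattice : OrderTheoretic.BoundedLattice c ℓ ℓ
  orderTheoreticLattice = record
    { Carrier = Carrier ; _≈_ = _≈_ ; _≤_ = _≤_ ; _∨_ = _∨_ ; _∧_ = _∧_ ; ⊤ = 𝟙 ; ⊥ = 𝟘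
    ; isBoundedLattice = record
      { isLattice = record
        { isPartialOrder = record
          { isPreorder = record
            { isEquivalence = isEquivalence
            ; reflexive     = sym ∘ Natural.reflexive
            ; trans         = λ p q → sym (Natural.trans (sym p) (sym q))
            }
          ; antisym = λ p q → Natural.antisym (sym p) (sym q)
          }
        ; supremum = λ x y → let ub₁ , ub₂ , least = Natural.supremum x y in
                       sym ub₁ , sym ub₂ , λ z p q → sym (least z (sym p) (sym q))
        ; infimum  = λ x y → let lb₁ , lb₂ , greatest = Natural.infimum x y in
                       sym lb₁ , sym lb₂ , λ z p q → sym (greatest z (sym p) (sym q))
        }
      ; maximum = 𝟙-greatest
      ; minimum = 𝟘-least
      }
    }
    where
    module Natural = OrderTheoretic.Lattice
      (AlgebraicLatticeProperties.∨-∧-orderTheoreticLattice lattice)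

  open OrderTheoretic.BoundedLattice orderTheoreticLattice
    using (poset; joinSemilattice; meetSemilattice; boundedJoinSemilattice;
           antisym; ≤-respˡ-≈; ≤-respʳ-≈; x≤x∨y; y≤x∨y; ∨-least; x∧y≤x; x∧y≤y; ∧-greatest)
    renaming (refl to ≤-refl; trans to ≤-trans)
  open JoinSemilatticeProperties joinSemilattice using (∨-monotonic)
  open MeetSemilatticeProperties meetSemilattice using (∧-monotonic)
  open BoundedJoinSemilatticeProperties boundedJoinSemilattice
    using () renaming (identityʳ to ∨-identityʳ)
  open AlgebraicLatticeProperties lattice using (∧-idem)
  open ≤-Reasoning poset

  ≤𝟘⇒≈𝟘 : ∀ {x} → x ≤ 𝟘 → x ≈ 𝟘
  ≤𝟘⇒≈𝟘 p = antisym p (𝟘-least _)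

  ¬-injective : ∀ {x y} → ¬ x ≈ ¬ y → x ≈ y
  ¬-injective {x} {y} p = trans (sym (¬-invol x)) (trans (¬-cong p) (¬-invol y))

  ¬-reflects-≤ : ∀ {x y} → ¬ x ≤ ¬ y → y ≤ x
  ¬-reflects-≤ {x} {y} p = begin
    y       ≈⟨ ¬-invol y ⟨
    ¬ ¬ y   ≤⟨ ¬-antitone p ⟩
    ¬ ¬ x   ≈⟨ ¬-invol x ⟩
    x       ∎

  x≤¬y⇒y≤¬x : ∀ {x y} → x ≤ ¬ y → y ≤ ¬ x
  x≤¬y⇒y≤¬x {y = y} p = ≤-respˡ-≈ (¬-invol y) (¬-antitone p)

  ¬-∨ : ∀ x y → ¬ (x ∨ y) ≈ ¬ x ∧ ¬ y
  ¬-∨ x y = antisym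
    (∧-greatest (¬-antitone (x≤x∨y x y)) (¬-antitone (y≤x∨y x y)))
    (x≤¬y⇒y≤¬x (∨-least (x≤¬y⇒y≤¬x (x∧y≤x _ _)) (x≤¬y⇒y≤¬x (x∧y≤y _ _))))

  ¬-∧ : ∀ x y → ¬ (x ∧ y) ≈ ¬ x ∨ ¬ y
  ¬-∧ x y = begin-equality
    ¬ (x ∧ y)           ≈⟨ ¬-cong (∧-cong (¬-invol x) (¬-invol y)) ⟨
    ¬ (¬ ¬ x ∧ ¬ ¬ y)   ≈⟨ ¬-cong (¬-∨ (¬ x) (¬ y)) ⟨
    ¬ ¬ (¬ x ∨ ¬ y)     ≈⟨ ¬-invol _ ⟩
    ¬ x ∨ ¬ y           ∎

  ¬-𝟙 : ¬ 𝟙 ≈ 𝟘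
  ¬-𝟙 = ≤𝟘⇒≈𝟘 (≤-respʳ-≈ (¬-invol 𝟘) (¬-antitone (𝟙-greatest (¬ 𝟘))))

  ¬-𝟘 : ¬ 𝟘 ≈ 𝟙
  ¬-𝟘 = trans (¬-cong (sym ¬-𝟙)) (¬-invol 𝟙)

  ·-monoʳ : ∀ x {y y′} → y ≤ y′ → x · y ≤ x · y′
  ·-monoʳ x p = ∧-monotonic ≤-refl (∨-monotonic ≤-refl p)

  ⇒-monoʳ : ∀ x {y y′} → y ≤ y′ → x ⇒ y ≤ x ⇒ y′
  ⇒-monoʳ x p = ∨-monotonic ≤-refl (∧-monotonic ≤-refl p)

  ¬-· : ∀ x y → ¬ (x · y) ≈ ¬ x ∨ (¬ y ∧ ¬ ¬ x)
  ¬-· x y = begin-equality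
    ¬ (x ∧ (¬ x ∨ y))     ≈⟨ ¬-∧ x (¬ x ∨ y) ⟩
    ¬ x ∨ ¬ (¬ x ∨ y)     ≈⟨ ∨-congˡ (trans (¬-∨ (¬ x) y) (∧-comm _ _)) ⟩
    ¬ x ∨ (¬ y ∧ ¬ ¬ x)   ∎

  HookResidual : Set (c ⊔ ℓ)
  HookResidual = IsResidualOf· _⇒_

  IsResidualOf·-resp : ∀ {r r′} → (∀ x y → r x y ≈ r′ x y) → IsResidualOf· r → IsResidualOf· r′
  IsResidualOf·-resp r≈r′ res x y z = mk⇔
    (≤-respʳ-≈ (r≈r′ x z) ∘ to (res x y z))
    (from (res x y z) ∘ ≤-respʳ-≈ (sym (r≈r′ x z)))

  unit∧counit⇒hookResidual : (∀ x y → y ≤ x ⇒ (x · y)) → (∀ x z → x · (x ⇒ z) ≤ z) →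
                             HookResidual
  unit∧counit⇒hookResidual unit counit x y z = mk⇔
    (λ xy≤z → ≤-trans (unit x y) (⇒-monoʳ x xy≤z))
    (λ y≤x⇒z → ≤-trans (·-monoʳ x y≤x⇒z) (counit x z))

  hookResidual⇒coResidual· : HookResidual → IsCoResidualOf⇒ _·_
  hookResidual⇒coResidual· res x y z = ⇔.sym (res x y z)

  coResidual⇒hookResidual : ∀ {⊙} → IsCoResidualOf⇒ ⊙ → (∀ x y → x · y ≈ ⊙ x y) →
                            HookResidual
  coResidual⇒hookResidual co ·≈⊙ x y z = mk⇔
    (from (co x y z) ∘ ≤-respˡ-≈ (·≈⊙ x y))
    (≤-respˡ-≈ (sym (·≈⊙ x y)) ∘ to (co x y z))

  residual⇒·-zeroʳ : ∀ {r} → IsResidualOf· r → ∀ x → x · 𝟘 ≈ 𝟘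
  residual⇒·-zeroʳ res x = ≤𝟘⇒≈𝟘 (from (res x 𝟘 𝟘) (𝟘-least _))

  ·-zeroʳ⇒ortholattice : (∀ x → x · 𝟘 ≈ 𝟘) → IsOrtholattice
  ·-zeroʳ⇒ortholattice zero x = trans (∧-congˡ (sym (∨-identityʳ (¬ x)))) (zero x)

  OrthomodularLaw : Set (c ⊔ ℓ)
  OrthomodularLaw = ∀ x y → x ≤ y → y ≈ x ∨ (y ∧ ¬ x)

  ·-Absorptive : Set (c ⊔ ℓ)
  ·-Absorptive = ∀ x y → x ≤ y → y · x ≈ x

  orthomodularLaw⇒·-absorptive : OrthomodularLaw → ·-Absorptive
  orthomodularLaw⇒·-absorptive om x y x≤y =
    ¬-injective (trans (¬-· y x) (sym (om (¬ y) (¬ x) (¬-antitone x≤y))))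

  ·-absorptive⇒orthomodularLaw : ·-Absorptive → OrthomodularLaw
  ·-absorptive⇒orthomodularLaw absorb x y x≤y = begin-equality
    y                             ≈⟨ ¬-invol y ⟨
    ¬ ¬ y                         ≈⟨ ¬-cong (absorb (¬ y) (¬ x) (¬-antitone x≤y)) ⟨
    ¬ ((¬ x) · (¬ y))             ≈⟨ ¬-· (¬ x) (¬ y) ⟩
    ¬ ¬ x ∨ (¬ ¬ y ∧ ¬ ¬ ¬ x)     ≈⟨ ∨-cong (¬-invol x) (∧-cong (¬-invol y) (¬-invol (¬ x))) ⟩
    x ∨ (y ∧ ¬ x)                 ∎

  ·-absorptive⇒counit : ·-Absorptive → ∀ x z → x · (x ⇒ z) ≤ z
  ·-absorptive⇒counit absorb x z = begin
    x ∧ (¬ x ∨ (¬ x ∨ (x ∧ z)))   ≤⟨ ∧-monotonic ≤-refl (∨-least (x≤x∨y _ _) ≤-refl) ⟩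
    x ∧ (¬ x ∨ (x ∧ z))           ≈⟨ absorb (x ∧ z) x (x∧y≤x x z) ⟩
    x ∧ z                         ≤⟨ x∧y≤y x z ⟩
    z                             ∎

  counit⇒·-absorptive : (∀ x z → x · (x ⇒ z) ≤ z) → ·-Absorptive
  counit⇒·-absorptive counit x y x≤y = antisym
    (begin
      y · x         ≤⟨ ·-monoʳ y (≤-trans (∧-greatest x≤y ≤-refl) (y≤x∨y _ _)) ⟩
      y · (y ⇒ x)   ≤⟨ counit y x ⟩
      x             ∎)
    (∧-greatest x≤y (y≤x∨y _ _))

  orthomodularLaw⇒unit : OrthomodularLaw → ∀ x y → y ≤ x ⇒ (x · y)
  orthomodularLaw⇒unit om x y = begin
    y                             ≤⟨ y≤x∨y (¬ x) y ⟩
    ¬ x ∨ y                       ≈⟨ om (¬ x) (¬ x ∨ y) (x≤x∨y _ _) ⟩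
    ¬ x ∨ ((¬ x ∨ y) ∧ ¬ ¬ x)     ≈⟨ ∨-congˡ (trans (∧-comm _ _) (∧-congʳ (¬-invol x))) ⟩
    ¬ x ∨ (x · y)                 ≤⟨ ∨-monotonic ≤-refl (∧-greatest (x∧y≤x _ _) ≤-refl) ⟩
    x ⇒ (x · y)                   ∎

  orthomodular⇒hookResidual : IsOrthomodular → HookResidual
  orthomodular⇒hookResidual (_ , om) = unit∧counit⇒hookResidual
    (orthomodularLaw⇒unit om)
    (·-absorptive⇒counit (orthomodularLaw⇒·-absorptive om))

  data Generated (u w : Carrier) : Set ℓ where
    ≈𝟘  : w ≈ 𝟘   → Generated u w
    ≈𝟙  : w ≈ 𝟙   → Generated u w
    ≈u  : w ≈ u   → Generated u w
    ≈¬u : w ≈ ¬ u → Generated u w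

  Generated-resp : ∀ {u w w′} → w ≈ w′ → Generated u w → Generated u w′
  Generated-resp w≈w′ (≈𝟘 p)  = ≈𝟘  (trans (sym w≈w′) p)
  Generated-resp w≈w′ (≈𝟙 p)  = ≈𝟙  (trans (sym w≈w′) p)
  Generated-resp w≈w′ (≈u p)  = ≈u  (trans (sym w≈w′) p)
  Generated-resp w≈w′ (≈¬u p) = ≈¬u (trans (sym w≈w′) p)

  Generated-¬ : ∀ {u w} → Generated u w → Generated u (¬ w)
  Generated-¬ (≈𝟘 p)  = ≈𝟙  (trans (¬-cong p) ¬-𝟘)
  Generated-¬ (≈𝟙 p)  = ≈𝟘  (trans (¬-cong p) ¬-𝟙)
  Generated-¬ (≈u p)  = ≈¬u (¬-cong p)
  Generated-¬ (≈¬u p) = ≈u  (trans (¬-cong p) (¬-invol _))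

  module Ortholattice (ortho : IsOrtholattice) where

    weaklyOrthomodular⇒orthomodularLaw : (∀ x y → x ≤ y → y ∧ ¬ x ≈ 𝟘 → y ≤ x) →
                                         OrthomodularLaw
    weaklyOrthomodular⇒orthomodularLaw weak x y x≤y = antisym (weak x′ y x′≤y y∧¬x′≈𝟘) x′≤y
      where
      x′ = x ∨ (y ∧ ¬ x)
      x′≤y : x′ ≤ y
      x′≤y = ∨-least x≤y (x∧y≤x _ _)
      y∧¬x′≈𝟘 : y ∧ ¬ x′ ≈ 𝟘
      y∧¬x′≈𝟘 = ≤𝟘⇒≈𝟘 (begin
        y ∧ ¬ x′                      ≤⟨ ∧-greatest (∧-monotonic ≤-refl (¬-antitone (x≤x∨y _ _)))
                                                    (≤-trans (x∧y≤y _ _) (¬-antitone (y≤x∨y _ _))) ⟩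
        (y ∧ ¬ x) ∧ ¬ (y ∧ ¬ x)       ≈⟨ ortho (y ∧ ¬ x) ⟩
        𝟘                             ∎)

    Generated-∧ : ∀ {u a b} → Generated u a → Generated u b → Generated u (a ∧ b)
    Generated-∧ (≈𝟘 p) _ = ≈𝟘 (≤𝟘⇒≈𝟘 (≤-respʳ-≈ p (x∧y≤x _ _)))
    Generated-∧ _ (≈𝟘 q) = ≈𝟘 (≤𝟘⇒≈𝟘 (≤-respʳ-≈ q (x∧y≤y _ _)))
    Generated-∧ (≈𝟙 p) g = Generated-resp (sym (trans (∧-congʳ p) (trans (∧-comm 𝟙 _) (𝟙-greatest _)))) g
    Generated-∧ g (≈𝟙 q) = Generated-resp (sym (trans (∧-congˡ q) (𝟙-greatest _))) g
    Generated-∧ (≈u p)  (≈u q)  = ≈u  (trans (∧-cong p q) (∧-idem _))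
    Generated-∧ (≈u p)  (≈¬u q) = ≈𝟘  (trans (∧-cong p q) (ortho _))
    Generated-∧ (≈¬u p) (≈u q)  = ≈𝟘  (trans (∧-cong p q) (trans (∧-comm _ _) (ortho _)))
    Generated-∧ (≈¬u p) (≈¬u q) = ≈¬u (trans (∧-cong p q) (∧-idem _))

    Generated-∨ : ∀ {u a b} → Generated u a → Generated u b → Generated u (a ∨ b)
    Generated-∨ {a = a} {b} g h = Generated-resp
      (trans (¬-∧ (¬ a) (¬ b)) (∨-cong (¬-invol a) (¬-invol b)))
      (Generated-¬ (Generated-∧ (Generated-¬ g) (Generated-¬ h)))

    Generated-⟦⟧ : ∀ {u x y} t → Generated u x → Generated u y → Generated u (⟦_⟧ A t x y)
    Generated-⟦⟧ varX     g h = g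
    Generated-⟦⟧ varY     g h = h
    Generated-⟦⟧ (s ∧ₜ t) g h = Generated-∧ (Generated-⟦⟧ s g h) (Generated-⟦⟧ t g h)
    Generated-⟦⟧ (s ∨ₜ t) g h = Generated-∨ (Generated-⟦⟧ s g h) (Generated-⟦⟧ t g h)
    Generated-⟦⟧ (¬ₜ t)   g h = Generated-¬ (Generated-⟦⟧ t g h)
    Generated-⟦⟧ 0ₜ       g h = ≈𝟘 refl
    Generated-⟦⟧ 1ₜ       g h = ≈𝟙 refl

    -- The residual is probed at (y, ¬y): it bounds ¬x from above and, being a term,
    -- takes one of the four values 𝟘, 𝟙, y, ¬y.
    termResidual⇒weaklyOrthomodular : ∀ t → IsResidualOf· (⟦_⟧ A t) →
                                      ∀ x y → x ≤ y → y ∧ ¬ x ≈ 𝟘 → y ≤ x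
    termResidual⇒weaklyOrthomodular t res x y x≤y y∧¬x≈𝟘 =
      cases (Generated-⟦⟧ t (≈u refl) (≈¬u refl))
      where
      r = ⟦_⟧ A t
      ¬x≤r : ¬ x ≤ r y (¬ y)
      ¬x≤r = to (res y (¬ x) (¬ y)) (begin
        y ∧ (¬ y ∨ ¬ x)   ≤⟨ ∧-monotonic ≤-refl (∨-least (¬-antitone x≤y) ≤-refl) ⟩
        y ∧ ¬ x           ≈⟨ y∧¬x≈𝟘 ⟩
        𝟘                 ≤⟨ 𝟘-least _ ⟩
        ¬ y               ∎)
      ¬x≤𝟘⇒y≤x : ¬ x ≤ 𝟘 → y ≤ x
      ¬x≤𝟘⇒y≤x ¬x≤𝟘 = ¬-reflects-≤ (≤-trans ¬x≤𝟘 (𝟘-least _))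
      cases : Generated y (r y (¬ y)) → y ≤ x
      cases (≈𝟘 p)  = ¬x≤𝟘⇒y≤x (≤-respʳ-≈ p ¬x≤r)
      cases (≈𝟙 p)  = begin
        y         ≤⟨ ∧-greatest ≤-refl y≤¬y ⟩
        y ∧ ¬ y   ≈⟨ ortho y ⟩
        𝟘         ≤⟨ 𝟘-least x ⟩
        x         ∎
        where
        y≤¬y : y ≤ ¬ y
        y≤¬y = begin
          y         ≤⟨ ∧-greatest ≤-refl (≤-trans (𝟙-greatest y) (y≤x∨y _ _)) ⟩
          y · 𝟙     ≤⟨ from (res y 𝟙 (¬ y)) (≤-respʳ-≈ (sym p) ≤-refl) ⟩
          ¬ y       ∎
      cases (≈u p)  = ¬x≤𝟘⇒y≤x (≤-respʳ-≈ y∧¬x≈𝟘 (∧-greatest (≤-respʳ-≈ p ¬x≤r) ≤-refl))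
      cases (≈¬u p) = ¬-reflects-≤ (≤-respʳ-≈ p ¬x≤r)

  termResidual⇒orthomodular : Cond6 → IsOrthomodular
  termResidual⇒orthomodular (t , res) =
    ortho , weaklyOrthomodular⇒orthomodularLaw (termResidual⇒weaklyOrthomodular t res)
    where
    ortho = ·-zeroʳ⇒ortholattice (residual⇒·-zeroʳ res)
    open Ortholattice ortho

  orthomodular⇒·-absorptive : Cond1 → Cond2
  orthomodular⇒·-absorptive (_ , om) = orthomodularLaw⇒·-absorptive om

  ·-absorptive⇒orthomodular : Cond2 → Cond1
  ·-absorptive⇒orthomodular absorb =
    ·-zeroʳ⇒ortholattice (λ x → absorb 𝟘 x (𝟘-least x)) , ·-absorptive⇒orthomodularLaw absorb

  hookResidual⇒cond4 : HookResidual → Cond4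
  hookResidual⇒cond4 res = (_⇒_ , res) , _·_ , hookResidual⇒coResidual· res , λ _ _ → refl

  cond4⇒hookResidual : Cond4 → HookResidual
  cond4⇒hookResidual (_ , _ , co , ·≈⊙) = coResidual⇒hookResidual co ·≈⊙

  hookResidual⇒cond5 : HookResidual → Cond5
  hookResidual⇒cond5 res = _⇒_ , res , λ _ _ → refl

  cond5⇒hookResidual : Cond5 → HookResidual
  cond5⇒hookResidual (_ , res , ·≈⇒) = IsResidualOf·-resp ·≈⇒ res

  hookResidual⇒cond6 : HookResidual → Cond6
  hookResidual⇒cond6 res = (¬ₜ varX) ∨ₜ (varX ∧ₜ varY) , res

  hookResidual⇒orthomodular : HookResidual → Cond1
  hookResidual⇒orthomodular = termResidual⇒orthomodular ∘ hookResidual⇒cond6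

proposition2p8 : ∀ {c ℓ} (A : BoundedInvolutiveLattice c ℓ) →
    let open Conditions A in
    (Cond1 ⇔ Cond2) × (Cond1 ⇔ Cond3) × (Cond1 ⇔ Cond4) ×
    (Cond1 ⇔ Cond5) × (Cond1 ⇔ Cond6)
proposition2p8 A =
  mk⇔ orthomodular⇒·-absorptive ·-absorptive⇒orthomodular ,
  mk⇔ (·-absorptive⇒counit ∘ orthomodular⇒·-absorptive)
      (·-absorptive⇒orthomodular ∘ counit⇒·-absorptive) ,
  mk⇔ (hookResidual⇒cond4 ∘ orthomodular⇒hookResidual) (hookResidual⇒orthomodular ∘ cond4⇒hookResidual) ,
  mk⇔ (hookResidual⇒cond5 ∘ orthomodular⇒hookResidual) (hookResidual⇒orthomodular ∘ cond5⇒hookResidual) ,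
  mk⇔ (hookResidual⇒cond6 ∘ orthomodular⇒hookResidual) termResidual⇒orthomodular
  where open Properties A
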